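{- Let $n\ge 1$. The map $\mathcal{F}\mapsto G_{\mathcal{F}}$ is a one-to-one correspondence between s-extremal families $\mathcal{F}\subseteq 2^{[n]}$ of Vapnik–Chervonenkis dimension $1$ satisfying $\bigcup_{F\in\mathcal{F}}F=[n]$ and $\bigcap_{F\in\mathcal{F}}F=\emptyset$, and directed edge-labelled trees on $n+1$ vertices (up to isomorphism preserving edge directions and labels) whose $n$ edges carry pairwise different labels from $[n]$.
   Context: $[n]=\{1,\dots,n\}$. A family $\mathcal{F}\subseteq 2^{[n]}$ shatters $S\subseteq[n]$ if $\{F\cap S: F\in\mathcal{F}\}=2^S$; $Sh(\mathcal{F})$ is the family of all sets shattered by $\mathcal{F}$; $\mathcal{F}$ is s-extremal if $|Sh(\mathcal{F})|=|\mathcal{F}|$. The Vapnik–Chervonenkis dimension of $\mathcal{F}$ is the maximum size of a set shattered by $\mathcal{F}$. The inclusion graph $G_{\mathcal{F}}$ has vertex set $\mathcal{F}$, with a directed edge from $G$ to $F$ labelled $j$ exactly when $j\notin G$ and $F=G\cup\{j\}$. (Conversely, such a directed edge-labelled tree $T$ determines the family $\{F_v: v\in T\}$ where, for each edge labelled $s$ going from $u$ to $v$, the label $s$ is put into $F_w$ for every vertex $w$ closer to $v$ than to $u$.) -}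

module Defs where

open import Data.Nat using (ℕ; zero; suc; _+_; _≤_)
open import Data.Bool using (Bool; true; false; if_then_else_)
open import Data.Fin using (Fin)
open import Data.Fin.Subset
  using (Subset; inside; outside; _∈_; _∉_; _⊆_; _∩_; _∪_; ⁅_⁆; ∣_∣)
open import Data.Fin.Subset.Properties using (_⊆?_; anySubset?)
open import Data.Vec using (_∷_; [])
open import Data.Vec.Properties using (≡-dec)
open import Data.Product using (Σ; ∃; ∃-syntax; _×_; _,_)
open import Data.Unit using (⊤)
open import Function using (_∘_)
open import Relation.Nullary using (Dec; yes; no; ¬_; does)
open import Relation.Nullary.Decidable using (_×-dec_; _→-dec_)
open import Relation.Binary.PropositionalEquality using (_≡_; _≢_)
import Data.Bool as B

Family : ℕ → Set
Family n = Subset n → Bool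

_∈𝓕_ : ∀ {n} → Subset n → Family n → Set
G ∈𝓕 𝓕 = 𝓕 G ≡ true

count : ∀ {n} → (Subset n → Bool) → ℕ
count {zero}  f = if f [] then 1 else 0
count {suc n} f = count (f ∘ (inside ∷_)) + count (f ∘ (outside ∷_))

card : ∀ {n} → Family n → ℕ
card 𝓕 = count 𝓕

-- 𝓕 shatters S : {G ∩ S : G ∈ 𝓕} = 2^S
-- (the inclusion {G ∩ S} ⊆ 2^S is automatic)
Shatters : ∀ {n} → Family n → Subset n → Set
Shatters 𝓕 S = ∀ T → T ⊆ S → ∃[ G ] (G ∈𝓕 𝓕 × G ∩ S ≡ T)

shatters? : ∀ {n} (𝓕 : Family n) (S : Subset n) → Dec (Shatters 𝓕 S)
shatters? {n} 𝓕 S with anySubset? (λ T → ¬? (P? T))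
  where
    P : Subset n → Set
    P T = T ⊆ S → ∃[ G ] (G ∈𝓕 𝓕 × G ∩ S ≡ T)
    P? : ∀ T → Dec (P T)
    P? T = (T ⊆? S) →-dec anySubset? (λ G → (𝓕 G B.≟ true) ×-dec ≡-dec B._≟_ (G ∩ S) T)
    ¬? : ∀ {A : Set} → Dec A → Dec (¬ A)
    ¬? (yes a) = no (λ f → f a)
    ¬? (no f) = yes f
... | yes (T , ¬PT) = no (λ sh → ¬PT (sh T))
... | no ¬∃ = yes (λ T T⊆S → dne T T⊆S)
  where
    dne : Shatters 𝓕 S
    dne T T⊆S with (T ⊆? S) →-dec anySubset? (λ G → (𝓕 G B.≟ true) ×-dec ≡-dec B._≟_ (G ∩ S) T)
    ... | yes p = p T⊆S
    ... | no ¬p = Data.Empty.⊥-elim (¬∃ (T , ¬p))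
      where import Data.Empty

Sh : ∀ {n} → Family n → Family n
Sh 𝓕 S = does (shatters? 𝓕 S)

SExtremal : ∀ {n} → Family n → Set
SExtremal 𝓕 = card (Sh 𝓕) ≡ card 𝓕

VCdim≡ : ∀ {n} → Family n → ℕ → Set
VCdim≡ 𝓕 d = (∃[ S ] (Shatters 𝓕 S × ∣ S ∣ ≡ d))
           × (∀ S → Shatters 𝓕 S → ∣ S ∣ ≤ d)

UnionFull : ∀ {n} → Family n → Set
UnionFull 𝓕 = ∀ i → ∃[ G ] (G ∈𝓕 𝓕 × i ∈ G)

InterEmpty : ∀ {n} → Family n → Set
InterEmpty 𝓕 = ∀ i → ∃[ G ] (G ∈𝓕 𝓕 × i ∉ G)

Admissible : ∀ {n} → Family n → Set
Admissible 𝓕 = SExtremal 𝓕 × VCdim≡ 𝓕 1 × UnionFull 𝓕 × InterEmpty 𝓕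

-- Directed edge-labelled graphs on n+1 vertices (vertex set Fin (suc n))
-- with n edges carrying pairwise different labels from [n]:
-- the edge labelled j goes from src j to tgt j.

record LGraph (n : ℕ) : Set where
  field
    src : Fin n → Fin (suc n)
    tgt : Fin n → Fin (suc n)
open LGraph public

data Walk {n} (T : LGraph n) (A : Fin n → Set) (u : Fin (suc n))
     : Fin (suc n) → Set where
  stay : Walk T A u u
  fwd  : ∀ j → A j → Walk T A u (src T j) → Walk T A u (tgt T j)
  bwd  : ∀ j → A j → Walk T A u (tgt T j) → Walk T A u (src T j)

-- tree: the underlying undirected (multi)graph is connected and acyclic;
-- acyclic is expressed as "every edge is a bridge" (removing it
-- disconnects its endpoints; this also excludes loops).
IsTree : ∀ {n} → LGraph n → Set
IsTree {n} T =
    (∀ u v → Walk T (λ _ → ⊤) u v)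
  × (∀ j → ¬ Walk T (λ k → k ≢ j) (src T j) (tgt T j))

-- The inclusion graph G_𝓕: vertices are the members of 𝓕, edge from G to
-- F labelled j iff j ∉ G and F = G ∪ {j}.

record _≅G_ {n} (𝓕 : Family n) (T : LGraph n) : Set where
  field
    φ      : Fin (suc n) → Subset n
    φ-inj  : ∀ u v → φ u ≡ φ v → u ≡ v
    φ-into : ∀ u → φ u ∈𝓕 𝓕
    φ-onto : ∀ G → G ∈𝓕 𝓕 → ∃[ u ] (φ u ≡ G)
    edges  : ∀ u v j →
      ((src T j ≡ u × tgt T j ≡ v) → (j ∉ φ u × φ v ≡ φ u ∪ ⁅ j ⁆))
      × ((j ∉ φ u × φ v ≡ φ u ∪ ⁅ j ⁆) → (src T j ≡ u × tgt T j ≡ v))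

-- Write n = m+1.  The argument rests on four general facts, proved in turn:
--  (1) Sauer–Shelah for VC-dimension ≤ 1: a family on [n] shattering no
--      pair has at most n+1 members (by induction, splitting 𝓕 into its
--      shadow and its twins along the first coordinate).
--  (2) If 𝓕 shatters no pair, ⋃𝓕 = [n] and ⋂𝓕 = ∅, then Sh(𝓕) is the
--      family of sets of size ≤ 1, so 𝓕 is admissible iff |𝓕| = n+1.
--  (3) A family of maximum size shattering no pair has a connected
--      inclusion graph (induction again: lift paths of the shadow).
--  (4) In such a family each label j occurs on exactly one edge of G_𝓕.
-- By (3) and (4), G_𝓕 is a labelled tree.  Conversely, a labelled tree T
-- yields the family whose vertex sets record on which side of each edge a
-- vertex lies; it satisfies (2) and G_𝓕 ≅ T.  Finally, the sets of the
-- vertices of a connected T are forced along walks, so T determines 𝓕.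
module Submission where

open import Defs
open import Data.Nat using (ℕ; _≤_)
open import Data.Product using (∃-syntax; _×_)
open import Relation.Binary.PropositionalEquality using (_≡_)

open import Data.Bool as Bool using (Bool; true; false; not; _∨_; _∧_; if_then_else_)
open import Data.Bool.Properties using (∨-zeroʳ; ∨-identityʳ; ∧-identityʳ; ∧-zeroʳ; ¬-not; not-¬; ⇔→≡)
open import Data.Empty using (⊥; ⊥-elim)
open import Data.Fin using (Fin; zero; suc; _≟_; splitAt; join; _↑ˡ_; _↑ʳ_)
open import Data.Fin.Properties using (join-splitAt; splitAt-↑ˡ; splitAt-↑ʳ)
import Data.Fin.Properties as FinP
open import Data.Fin.Subset using (Subset; inside; outside; _∈_; _∉_; _∩_; _∪_; ⁅_⁆; ∣_∣)
open import Data.Fin.Subset.Properties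
  using ( x∈⁅x⁆; x∈⁅y⁆⇒x≡y; x≢y⇒x∉⁅y⁆; drop-there; ∪-identityʳ; p∩q⊆q; x∈p∪q⁺; x∈p∪q⁻
        ; nonempty?; ∣⁅x⁆∣≡1; p⊆q⇒∣p∣≤∣q∣; x∈p∧x≢y⇒x∈p-y; x∈p⇒∣p-x∣<∣p∣ )
open import Data.Nat using (zero; suc; _+_; _<_; z≤n; s≤s; _≤?_)
open import Data.Nat.Properties using (module ≤-Reasoning; +-commutativeSemigroup; ≤-trans; ≤-reflexive; +-mono-≤; +-comm; +-identityʳ; +-suc; suc-injective; 1+n≰n)
open import Data.Product using (_,_; proj₁; proj₂)
open import Data.Sum using (_⊎_; inj₁; inj₂; [_,_]′; map)
open import Data.List using (List; []; _∷_; allFin)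
open import Data.List.Membership.Propositional using () renaming (_∈_ to _∈ₗ_)
open import Data.List.Membership.Propositional.Properties using (∈-allFin)
open import Data.List.Relation.Unary.Any using () renaming (here to hereₗ; there to thereₗ)
open import Data.Unit using (⊤; tt)
open import Data.Vec using ([]; _∷_; lookup; tabulate; here; there)
open import Data.Vec.Properties using ([]=⇒lookup; lookup⇒[]=; lookup-zipWith; lookup∘tabulate; ≡-dec; ∷-injectiveˡ; ∷-injectiveʳ)
open import Function using (_∘_)
open import Function.Bundles using (mk⇔)
open import Algebra.Properties.CommutativeSemigroup +-commutativeSemigroup using (interchange)
open import Relation.Nullary using (¬_; Dec; yes; no; does)
open import Relation.Nullary.Decidable using (dec-true; dec-false)
open import Relation.Binary.PropositionalEquality
  using (_≢_; refl; sym; trans; cong; cong₂; subst; subst₂; module ≡-Reasoning)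

true≢false : true ≢ false
true≢false ()

subset-ext : ∀ {m} {a b : Subset m} → (∀ i → lookup a i ≡ lookup b i) → a ≡ b
subset-ext {a = []}    {[]}    _  = refl
subset-ext {a = _ ∷ _} {_ ∷ _} eq = cong₂ _∷_ (eq zero) (subset-ext (eq ∘ suc))

∈⇒true : ∀ {m} {i : Fin m} {a} → i ∈ a → lookup a i ≡ true
∈⇒true = []=⇒lookup

true⇒∈ : ∀ {m} {i : Fin m} {a} → lookup a i ≡ true → i ∈ a
true⇒∈ {i = i} {a} = lookup⇒[]= i a

∉⇒false : ∀ {m} {i : Fin m} {a} → i ∉ a → lookup a i ≡ false
∉⇒false {i = i} {a} i∉a with lookup a i in eq
... | true  = ⊥-elim (i∉a (true⇒∈ eq))
... | false = refl

false⇒∉ : ∀ {m} {i : Fin m} {a} → lookup a i ≡ false → i ∉ a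
false⇒∉ eq i∈a = true≢false (trans (sym (∈⇒true i∈a)) eq)

lookup-∪ : ∀ {m} (a b : Subset m) i → lookup (a ∪ b) i ≡ (lookup a i ∨ lookup b i)
lookup-∪ a b i = lookup-zipWith _∨_ i a b

lookup-∩ : ∀ {m} (a b : Subset m) i → lookup (a ∩ b) i ≡ (lookup a i ∧ lookup b i)
lookup-∩ a b i = lookup-zipWith _∧_ i a b

_─[_]→_ : ∀ {m} → Subset m → Fin m → Subset m → Set
b ─[ j ]→ c = j ∉ b × c ≡ b ∪ ⁅ j ⁆

_─[_]─_ : ∀ {m} → Subset m → Fin m → Subset m → Set
b ─[ j ]─ c = b ─[ j ]→ c ⊎ c ─[ j ]→ b

lookup-∪⁅⁆-same : ∀ {m} (b : Subset m) j → lookup (b ∪ ⁅ j ⁆) j ≡ true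
lookup-∪⁅⁆-same b j = begin
  lookup (b ∪ ⁅ j ⁆) j        ≡⟨ lookup-∪ b ⁅ j ⁆ j ⟩
  lookup b j ∨ lookup ⁅ j ⁆ j ≡⟨ cong (lookup b j ∨_) (∈⇒true (x∈⁅x⁆ j)) ⟩
  lookup b j ∨ true           ≡⟨ ∨-zeroʳ _ ⟩
  true                        ∎
  where open ≡-Reasoning

lookup-∪⁅⁆-other : ∀ {m} (b : Subset m) {j} l → l ≢ j → lookup (b ∪ ⁅ j ⁆) l ≡ lookup b l
lookup-∪⁅⁆-other b {j} l l≢j = begin
  lookup (b ∪ ⁅ j ⁆) l        ≡⟨ lookup-∪ b ⁅ j ⁆ l ⟩
  lookup b l ∨ lookup ⁅ j ⁆ l ≡⟨ cong (lookup b l ∨_) (∉⇒false (x≢y⇒x∉⁅y⁆ l≢j)) ⟩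
  lookup b l ∨ false          ≡⟨ ∨-identityʳ _ ⟩
  lookup b l                  ∎
  where open ≡-Reasoning

module _ {m} {b c : Subset m} {j : Fin m} where

  edge-source : b ─[ j ]→ c → lookup b j ≡ false
  edge-source (j∉b , _) = ∉⇒false j∉b

  edge-target : b ─[ j ]→ c → lookup c j ≡ true
  edge-target (_ , refl) = lookup-∪⁅⁆-same b j

  edge-other : b ─[ j ]→ c → ∀ l → l ≢ j → lookup c l ≡ lookup b l
  edge-other (_ , refl) = lookup-∪⁅⁆-other b

  edge-intro : lookup b j ≡ false → lookup c j ≡ true →
               (∀ l → l ≢ j → lookup c l ≡ lookup b l) → b ─[ j ]→ c
  edge-intro bj cj agree = false⇒∉ bj , subset-ext pointwise
    where
    pointwise : ∀ l → lookup c l ≡ lookup (b ∪ ⁅ j ⁆) l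
    pointwise l with l ≟ j
    ... | yes refl = trans cj (sym (lookup-∪⁅⁆-same b j))
    ... | no l≢j   = trans (agree l l≢j) (sym (lookup-∪⁅⁆-other b l l≢j))

adjacent-differ : ∀ {m} {b c : Subset m} {j} → b ─[ j ]─ c → lookup b j ≢ lookup c j
adjacent-differ (inj₁ e) eq = true≢false (trans (sym (edge-target e)) (trans (sym eq) (edge-source e)))
adjacent-differ (inj₂ e) eq = true≢false (trans (sym (edge-target e)) (trans eq (edge-source e)))

adjacent-agree : ∀ {m} {b c : Subset m} {j} → b ─[ j ]─ c → ∀ l → l ≢ j → lookup b l ≡ lookup c l
adjacent-agree (inj₁ e) l l≢j = sym (edge-other e l l≢j)
adjacent-agree (inj₂ e) l l≢j = edge-other e l l≢j

edge-cons : ∀ {m} x {b c : Subset m} {j} → b ─[ j ]→ c → (x ∷ b) ─[ suc j ]→ (x ∷ c)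
edge-cons x (j∉b , refl) = j∉b ∘ drop-there , cong (_∷ _) (sym (∨-identityʳ x))

adjacent-cons : ∀ {m} x {b c : Subset m} {j} → b ─[ j ]─ c → (x ∷ b) ─[ suc j ]─ (x ∷ c)
adjacent-cons x (inj₁ e) = inj₁ (edge-cons x e)
adjacent-cons x (inj₂ e) = inj₂ (edge-cons x e)

edge-head : ∀ {m} (b : Subset m) → (outside ∷ b) ─[ zero ]→ (inside ∷ b)
edge-head b = (λ ()) , cong (inside ∷_) (sym (∪-identityʳ b))

data Path {m} (𝓕 : Family m) (a : Subset m) : Subset m → Set where
  start : Path 𝓕 a a
  step  : ∀ {b c} j → Path 𝓕 a b → b ─[ j ]─ c → c ∈𝓕 𝓕 → Path 𝓕 a c

path-end : ∀ {m} {𝓕 : Family m} {a b} → a ∈𝓕 𝓕 → Path 𝓕 a b → b ∈𝓕 𝓕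
path-end a∈ start            = a∈
path-end _  (step _ _ _ c∈) = c∈

Connected : ∀ {m} → Family m → Set
Connected 𝓕 = ∀ a b → a ∈𝓕 𝓕 → b ∈𝓕 𝓕 → Path 𝓕 a b

section : ∀ {m} → Family (suc m) → Bool → Family m
section 𝓕 x a = 𝓕 (x ∷ a)

count-cong : ∀ {m} (f g : Family m) → (∀ a → f a ≡ g a) → count f ≡ count g
count-cong {zero}  f g eq rewrite eq [] = refl
count-cong {suc m} f g eq =
  cong₂ _+_ (count-cong _ _ (eq ∘ (inside ∷_))) (count-cong _ _ (eq ∘ (outside ∷_)))

count-empty : ∀ {m} (f : Family m) → (∀ a → f a ≡ false) → count f ≡ 0
count-empty {zero}  f none rewrite none [] = refl
count-empty {suc m} f none =
  cong₂ _+_ (count-empty _ (none ∘ (inside ∷_))) (count-empty _ (none ∘ (outside ∷_)))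

_∪𝓕_ _∩𝓕_ : ∀ {m} → Family m → Family m → Family m
(f ∪𝓕 g) a = f a ∨ g a
(f ∩𝓕 g) a = f a ∧ g a

count-∪+∩ : ∀ {m} (f g : Family m) → count f + count g ≡ count (f ∪𝓕 g) + count (f ∩𝓕 g)
count-∪+∩ {zero} f g with f [] | g []
... | true  | true  = refl
... | true  | false = refl
... | false | true  = refl
... | false | false = refl
count-∪+∩ {suc m} f g = begin
  (count f₁ + count f₀) + (count g₁ + count g₀)   ≡⟨ interchange (count f₁) _ _ _ ⟩
  (count f₁ + count g₁) + (count f₀ + count g₀)   ≡⟨ cong₂ _+_ (count-∪+∩ f₁ g₁) (count-∪+∩ f₀ g₀) ⟩
  (count (f₁ ∪𝓕 g₁) + count (f₁ ∩𝓕 g₁)) + (count (f₀ ∪𝓕 g₀) + count (f₀ ∩𝓕 g₀))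
                                                  ≡⟨ interchange (count (f₁ ∪𝓕 g₁)) _ _ _ ⟩
  (count (f₁ ∪𝓕 g₁) + count (f₀ ∪𝓕 g₀)) + (count (f₁ ∩𝓕 g₁) + count (f₀ ∩𝓕 g₀)) ∎
  where
  open ≡-Reasoning
  f₁ f₀ g₁ g₀ : Family m
  f₁ = section f true ; f₀ = section f false
  g₁ = section g true ; g₀ = section g false

some-member : ∀ {m} (f : Family m) → 0 < count f → ∃[ a ] (a ∈𝓕 f)
some-member {zero} f pos with f [] in eq
... | true = [] , eq
some-member {zero} f () | false
some-member {suc m} f pos with count (section f true) in eq
... | suc _ = let (a , a∈) = some-member (section f true) (subst (0 <_) (sym eq) (s≤s z≤n)) in true ∷ a , a∈
... | zero  = let (a , a∈) = some-member (section f false) pos in false ∷ a , a∈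

record Enumeration {m} (𝓕 : Family m) (N : ℕ) : Set where
  field
    φ      : Fin N → Subset m
    φ-inj  : ∀ u v → φ u ≡ φ v → u ≡ v
    φ-into : ∀ u → φ u ∈𝓕 𝓕
    φ-onto : ∀ G → G ∈𝓕 𝓕 → ∃[ u ] (φ u ≡ G)

module Listing where

  listing : ∀ {m} (f : Family m) → Fin (count f) → Subset m
  halves  : ∀ {m} (f : Family (suc m)) →
            Fin (count (section f true)) ⊎ Fin (count (section f false)) → Subset (suc m)

  listing {zero}  f _ = []
  listing {suc m} f   = halves f ∘ splitAt (count (section f true))
  halves f = [ (inside ∷_) ∘ listing (section f true) , (outside ∷_) ∘ listing (section f false) ]′

  listing-into : ∀ {m} (f : Family m) u → listing f u ∈𝓕 f
  listing-into {zero} f u with f []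
  ... | true = refl
  listing-into {zero} f () | false
  listing-into {suc m} f u with splitAt (count (section f true)) u
  ... | inj₁ v = listing-into (section f true) v
  ... | inj₂ v = listing-into (section f false) v

  splitAt-injective : ∀ k {l} {u v : Fin (k + l)} → splitAt k u ≡ splitAt k v → u ≡ v
  splitAt-injective k {l} {u} {v} eq =
    trans (sym (join-splitAt k l u)) (trans (cong (join k l) eq) (join-splitAt k l v))

  listing-inj : ∀ {m} (f : Family m) u v → listing f u ≡ listing f v → u ≡ v
  listing-inj {zero} f u v _ with f []
  listing-inj {zero} f zero zero _ | true = refl
  listing-inj {zero} f () _ _ | false
  listing-inj {suc m} f u v eq
    with splitAt (count (section f true)) u in eu | splitAt (count (section f true)) v in ev
  ... | inj₁ u′ | inj₁ v′ = splitAt-injective _ (trans eu (trans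
          (cong inj₁ (listing-inj _ u′ v′ (∷-injectiveʳ eq))) (sym ev)))
  ... | inj₂ u′ | inj₂ v′ = splitAt-injective _ (trans eu (trans
          (cong inj₂ (listing-inj _ u′ v′ (∷-injectiveʳ eq))) (sym ev)))
  ... | inj₁ _ | inj₂ _ = ⊥-elim (true≢false (∷-injectiveˡ eq))
  ... | inj₂ _ | inj₁ _ = ⊥-elim (true≢false (sym (∷-injectiveˡ eq)))

  listing-onto : ∀ {m} (f : Family m) G → G ∈𝓕 f → ∃[ u ] (listing f u ≡ G)
  listing-onto {zero} f [] G∈ with f []
  ... | true = zero , refl
  listing-onto {zero} f [] () | false
  listing-onto {suc m} f (true ∷ G) G∈ =
    let (u , eq) = listing-onto (section f true) G G∈
    in u ↑ˡ _ , trans (cong (halves f) (splitAt-↑ˡ _ u _)) (cong (true ∷_) eq)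
  listing-onto {suc m} f (false ∷ G) G∈ =
    let (u , eq) = listing-onto (section f false) G G∈
    in _ ↑ʳ u , trans (cong (halves f) (splitAt-↑ʳ _ _ u)) (cong (false ∷_) eq)

open Listing

count⇒enumeration : ∀ {m} (f : Family m) {N} → count f ≡ N → Enumeration f N
count⇒enumeration f refl = record
  { φ = listing f ; φ-inj = listing-inj f ; φ-into = listing-into f ; φ-onto = listing-onto f }

enumeration⇒count : ∀ {m} {f : Family m} {N} → Enumeration f N → count f ≡ N
enumeration⇒count {f = f} e = FinP.cantor-schröder-bernstein {f = to} {g = from} to-inj from-inj
  where
  open Enumeration e
  to : Fin (count f) → Fin _
  to u = proj₁ (φ-onto (listing f u) (listing-into f u))
  from : Fin _ → Fin (count f)
  from v = proj₁ (listing-onto f (φ v) (φ-into v))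
  to-inj : ∀ {u v} → to u ≡ to v → u ≡ v
  to-inj {u} {v} eq = listing-inj f u v (trans (sym (proj₂ (φ-onto _ (listing-into f u))))
                        (trans (cong φ eq) (proj₂ (φ-onto _ (listing-into f v)))))
  from-inj : ∀ {u v} → from u ≡ from v → u ≡ v
  from-inj {u} {v} eq = φ-inj u v (trans (sym (proj₂ (listing-onto f _ (φ-into u))))
                          (trans (cong (listing f) eq) (proj₂ (listing-onto f _ (φ-into v)))))

ShattersPoint : ∀ {m} → Family m → Fin m → Set
ShattersPoint 𝓕 i = ∀ p → ∃[ a ] (a ∈𝓕 𝓕 × lookup a i ≡ p)

ShattersPair : ∀ {m} → Family m → Fin m → Fin m → Set
ShattersPair 𝓕 i j = ∀ p q → ∃[ a ] (a ∈𝓕 𝓕 × lookup a i ≡ p × lookup a j ≡ q)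

NoShatteredPoint : ∀ {m} → Family m → Set
NoShatteredPoint 𝓕 = ∀ i → ¬ ShattersPoint 𝓕 i

NoShatteredPair : ∀ {m} → Family m → Set
NoShatteredPair 𝓕 = ∀ i j → i ≢ j → ¬ ShattersPair 𝓕 i j

shadow twins : ∀ {m} → Family (suc m) → Family m
shadow 𝓕 = section 𝓕 true ∪𝓕 section 𝓕 false
twins  𝓕 = section 𝓕 true ∩𝓕 section 𝓕 false

count-shadow+twins : ∀ {m} (𝓕 : Family (suc m)) → count 𝓕 ≡ count (shadow 𝓕) + count (twins 𝓕)
count-shadow+twins 𝓕 = count-∪+∩ (section 𝓕 true) (section 𝓕 false)

module _ {m} (𝓕 : Family (suc m)) where

  shadow-member : ∀ {a} → a ∈𝓕 shadow 𝓕 → ∃[ x ] ((x ∷ a) ∈𝓕 𝓕)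
  shadow-member {a} a∈ with 𝓕 (true ∷ a) in eq
  ... | true  = true , eq
  ... | false = false , a∈

  member-shadow : ∀ {x a} → (x ∷ a) ∈𝓕 𝓕 → a ∈𝓕 shadow 𝓕
  member-shadow {true}      x∷a∈ rewrite x∷a∈ = refl
  member-shadow {false} {a} x∷a∈ rewrite x∷a∈ = ∨-zeroʳ (𝓕 (true ∷ a))

  twins-member : ∀ {a} → a ∈𝓕 twins 𝓕 → ∀ x → (x ∷ a) ∈𝓕 𝓕
  twins-member {a} a∈ x with 𝓕 (true ∷ a) in eq₁ | 𝓕 (false ∷ a) in eq₀ | x
  ... | true | true | true  = eq₁
  ... | true | true | false = eq₀
  twins-member () _ | true  | false | _
  twins-member () _ | false | _     | _

  shadow-point : ∀ {i} → ShattersPoint (shadow 𝓕) i → ShattersPoint 𝓕 (suc i)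
  shadow-point sh p = let (a , a∈ , ai) = sh p ; (x , x∷a∈) = shadow-member a∈ in x ∷ a , x∷a∈ , ai

  shadow-pair : ∀ {i j} → ShattersPair (shadow 𝓕) i j → ShattersPair 𝓕 (suc i) (suc j)
  shadow-pair sh p q =
    let (a , a∈ , ai , aj) = sh p q ; (x , x∷a∈) = shadow-member a∈ in x ∷ a , x∷a∈ , ai , aj

  twins-point : ∀ {i} → ShattersPoint (twins 𝓕) i → ShattersPair 𝓕 zero (suc i)
  twins-point sh p q = let (a , a∈ , ai) = sh q in p ∷ a , twins-member a∈ p , refl , ai

  shadow-noPair : NoShatteredPair 𝓕 → NoShatteredPair (shadow 𝓕)
  shadow-noPair np i j i≢j = np (suc i) (suc j) (i≢j ∘ FinP.suc-injective) ∘ shadow-pair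

  twins-noPoint : NoShatteredPair 𝓕 → NoShatteredPoint (twins 𝓕)
  twins-noPoint np i = np zero (suc i) (λ ()) ∘ twins-point

sauer₀ : ∀ {m} (𝓕 : Family m) → NoShatteredPoint 𝓕 → count 𝓕 ≤ 1
sauer₀ {zero} 𝓕 _ with 𝓕 []
... | true  = s≤s z≤n
... | false = z≤n
sauer₀ {suc m} 𝓕 none = begin
  count 𝓕                            ≡⟨ count-shadow+twins 𝓕 ⟩
  count (shadow 𝓕) + count (twins 𝓕) ≡⟨ cong (count (shadow 𝓕) +_) (count-empty (twins 𝓕) no-twins) ⟩
  count (shadow 𝓕) + 0               ≡⟨ +-identityʳ _ ⟩
  count (shadow 𝓕)                   ≤⟨ sauer₀ (shadow 𝓕) (λ i → none (suc i) ∘ shadow-point 𝓕) ⟩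
  1                                  ∎
  where
  open ≤-Reasoning
  -- twins would shatter coordinate zero
  no-twins : ∀ a → twins 𝓕 a ≡ false
  no-twins a = ¬-not (λ a∈ → none zero (λ x → x ∷ a , twins-member 𝓕 a∈ x , refl))

sauer₁ : ∀ {m} (𝓕 : Family m) → NoShatteredPair 𝓕 → count 𝓕 ≤ suc m
sauer₁ {zero} 𝓕 _ with 𝓕 []
... | true  = s≤s z≤n
... | false = z≤n
sauer₁ {suc m} 𝓕 np = begin
  count 𝓕                            ≡⟨ count-shadow+twins 𝓕 ⟩
  count (shadow 𝓕) + count (twins 𝓕) ≤⟨ +-mono-≤ (sauer₁ (shadow 𝓕) (shadow-noPair 𝓕 np))
                                                   (sauer₀ (twins 𝓕) (twins-noPoint 𝓕 np)) ⟩
  suc m + 1                          ≡⟨ +-comm (suc m) 1 ⟩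
  suc (suc m)                        ∎
  where open ≤-Reasoning

Realises : ∀ {m} → Family m → Subset m → Set
Realises {m} 𝓕 S = ∀ (t : Fin m → Bool) → ∃[ G ] (G ∈𝓕 𝓕 × (∀ l → lookup S l ≡ true → lookup G l ≡ t l))

shatters⇒realises : ∀ {m} {𝓕 : Family m} {S} → Shatters 𝓕 S → Realises 𝓕 S
shatters⇒realises {S = S} sh t =
  let (G , G∈ , G∩S≡T) = sh (tabulate t ∩ S) (p∩q⊆q _ _) in G , G∈ , λ l Sl → begin
    lookup G l                ≡⟨ sym (∧-identityʳ _) ⟩
    lookup G l ∧ true         ≡⟨ cong (lookup G l ∧_) (sym Sl) ⟩
    lookup G l ∧ lookup S l   ≡⟨ sym (lookup-∩ G S l) ⟩
    lookup (G ∩ S) l          ≡⟨ cong (λ X → lookup X l) G∩S≡T ⟩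
    lookup (tabulate t ∩ S) l ≡⟨ lookup-∩ (tabulate t) S l ⟩
    lookup (tabulate t) l ∧ lookup S l ≡⟨ cong₂ _∧_ (lookup∘tabulate t l) Sl ⟩
    t l ∧ true                ≡⟨ ∧-identityʳ _ ⟩
    t l                       ∎
  where open ≡-Reasoning

realises⇒shatters : ∀ {m} {𝓕 : Family m} {S} → Realises 𝓕 S → Shatters 𝓕 S
realises⇒shatters {S = S} re T T⊆S =
  let (G , G∈ , agree) = re (lookup T) in G , G∈ , subset-ext (pointwise G agree)
  where
  pointwise : ∀ G → (∀ l → lookup S l ≡ true → lookup G l ≡ lookup T l) →
              ∀ l → lookup (G ∩ S) l ≡ lookup T l
  pointwise G agree l rewrite lookup-∩ G S l with lookup S l in Sl
  ... | true  = trans (∧-identityʳ _) (agree l Sl)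
  ... | false = trans (∧-zeroʳ _) (sym (¬-not (λ Tl → true≢false (trans (sym (∈⇒true (T⊆S (true⇒∈ Tl)))) Sl))))

1≤∣S∣ : ∀ {m} {S : Subset m} {i} → i ∈ S → 1 ≤ ∣ S ∣
1≤∣S∣ {S = S} {i} i∈S = subst (_≤ ∣ S ∣) (∣⁅x⁆∣≡1 i)
  (p⊆q⇒∣p∣≤∣q∣ (λ l∈⁅i⁆ → subst (_∈ S) (sym (x∈⁅y⁆⇒x≡y i l∈⁅i⁆)) i∈S))

2≤∣S∣ : ∀ {m} {S : Subset m} {i j} → i ∈ S → j ∈ S → i ≢ j → 2 ≤ ∣ S ∣
2≤∣S∣ i∈S j∈S i≢j = ≤-trans (s≤s (1≤∣S∣ (x∈p∧x≢y⇒x∈p-y j∈S (i≢j ∘ sym)))) (x∈p⇒∣p-x∣<∣p∣ i∈S)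

element : ∀ {m} (S : Subset m) → ¬ ∣ S ∣ ≤ 0 → ∃[ i ] (i ∈ S)
element []          ¬≤ = ⊥-elim (¬≤ z≤n)
element (true ∷ S)  _  = zero , here
element (false ∷ S) ¬≤ = let (i , i∈) = element S ¬≤ in suc i , there i∈

two-elements : ∀ {m} (S : Subset m) → ¬ ∣ S ∣ ≤ 1 → ∃[ i ] ∃[ j ] (i ∈ S × j ∈ S × i ≢ j)
two-elements []          ¬≤ = ⊥-elim (¬≤ z≤n)
two-elements (true ∷ S)  ¬≤ = let (j , j∈) = element S (¬≤ ∘ s≤s) in zero , suc j , here , there j∈ , λ ()
two-elements (false ∷ S) ¬≤ =
  let (i , j , i∈ , j∈ , i≢j) = two-elements S ¬≤ in suc i , suc j , there i∈ , there j∈ , i≢j ∘ FinP.suc-injective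

pick : ∀ {m} → Fin m → Bool → Bool → Fin m → Bool
pick i p q l = if does (l ≟ i) then p else q

pick-at : ∀ {m} (i : Fin m) p q → pick i p q i ≡ p
pick-at i p q rewrite dec-true (i ≟ i) refl = refl

pick-else : ∀ {m} {i l : Fin m} p q → l ≢ i → pick i p q l ≡ q
pick-else {i = i} {l} p q l≢i rewrite dec-false (l ≟ i) l≢i = refl

noPair⇒vc≤1 : ∀ {m} {𝓕 : Family m} → NoShatteredPair 𝓕 → ∀ S → Shatters 𝓕 S → ∣ S ∣ ≤ 1
noPair⇒vc≤1 {𝓕 = 𝓕} np S sh with ∣ S ∣ ≤? 1
... | yes ≤1 = ≤1
... | no ≰1 = let (i , j , i∈ , j∈ , i≢j) = two-elements S ≰1 in ⊥-elim (np i j i≢j (pair i∈ j∈ i≢j))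
  where
  pair : ∀ {i j} → i ∈ S → j ∈ S → i ≢ j → ShattersPair 𝓕 i j
  pair {i} {j} i∈ j∈ i≢j p q =
    let (G , G∈ , agree) = shatters⇒realises sh (pick i p q)
    in G , G∈ , trans (agree i (∈⇒true i∈)) (pick-at i p q)
              , trans (agree j (∈⇒true j∈)) (pick-else p q (i≢j ∘ sym))

vc≤1⇒noPair : ∀ {m} {𝓕 : Family m} → (∀ S → Shatters 𝓕 S → ∣ S ∣ ≤ 1) → NoShatteredPair 𝓕
vc≤1⇒noPair {𝓕 = 𝓕} vc i j i≢j sh =
  1+n≰n (≤-trans (2≤∣S∣ (x∈p∪q⁺ (inj₁ (x∈⁅x⁆ i))) (x∈p∪q⁺ (inj₂ (x∈⁅x⁆ j))) i≢j)
                 (vc (⁅ i ⁆ ∪ ⁅ j ⁆) (realises⇒shatters realise)))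
  where
  realise : Realises 𝓕 (⁅ i ⁆ ∪ ⁅ j ⁆)
  realise t = let (G , G∈ , Gi , Gj) = sh (t i) (t j) in G , G∈ , λ l l∈ →
    [ (λ l∈⁅i⁆ → subst (λ k → lookup G k ≡ t k) (sym (x∈⁅y⁆⇒x≡y i l∈⁅i⁆)) Gi)
    , (λ l∈⁅j⁆ → subst (λ k → lookup G k ≡ t k) (sym (x∈⁅y⁆⇒x≡y j l∈⁅j⁆)) Gj)
    ]′ (x∈p∪q⁻ ⁅ i ⁆ ⁅ j ⁆ (true⇒∈ l∈))

small-shattered : ∀ {m} {𝓕 : Family (suc m)} → UnionFull 𝓕 → InterEmpty 𝓕 →
                  ∀ S → ∣ S ∣ ≤ 1 → Shatters 𝓕 S
small-shattered {𝓕 = 𝓕} full empty S ≤1 = realises⇒shatters realise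
  where
  unique : ∀ {i l} → i ∈ S → l ∈ S → l ≡ i
  unique {i} {l} i∈ l∈ with l ≟ i
  ... | yes l≡i = l≡i
  ... | no l≢i  = ⊥-elim (1+n≰n (≤-trans (2≤∣S∣ l∈ i∈ l≢i) ≤1))
  witness : ∀ i p → ∃[ G ] (G ∈𝓕 𝓕 × lookup G i ≡ p)
  witness i true  = let (G , G∈ , i∈G) = full i  in G , G∈ , ∈⇒true i∈G
  witness i false = let (G , G∈ , i∉G) = empty i in G , G∈ , ∉⇒false i∉G
  realise : Realises 𝓕 S
  realise t with nonempty? S
  ... | no  S-empty = let (G , G∈ , _) = full zero in G , G∈ , λ l Sl → ⊥-elim (S-empty (l , true⇒∈ Sl))
  ... | yes (i , i∈) = let (G , G∈ , Gi) = witness i (t i) in G , G∈ , λ l Sl →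
    subst (λ k → lookup G k ≡ t k) (sym (unique i∈ (true⇒∈ Sl))) Gi

does⇒proof : ∀ {P : Set} (p : Dec P) → does p ≡ true → P
does⇒proof (yes x) _ = x
does⇒proof (no _) ()

does-⇔ : ∀ {P Q : Set} (p : Dec P) (q : Dec Q) → (P → Q) → (Q → P) → does p ≡ does q
does-⇔ p q P→Q Q→P = ⇔→≡ {z = true} (mk⇔ (dec-true q ∘ P→Q ∘ does⇒proof p) (dec-true p ∘ Q→P ∘ does⇒proof q))

SizeAtMost : ℕ → ∀ {m} → Family m
SizeAtMost k S = does (∣ S ∣ ≤? k)

count-size≤0 : ∀ m → count (SizeAtMost 0 {m}) ≡ 1
count-size≤0 zero    = refl
count-size≤0 (suc m) = cong₂ _+_ (count-empty {m} _ (λ _ → refl)) (count-size≤0 m)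

count-size≤1 : ∀ m → count (SizeAtMost 1 {m}) ≡ suc m
count-size≤1 zero    = refl
count-size≤1 (suc m) = cong₂ _+_ (trans (count-cong {m} _ _ with-zero) (count-size≤0 m)) (count-size≤1 m)
  where
  with-zero : ∀ (S : Subset m) → SizeAtMost 1 (inside ∷ S) ≡ SizeAtMost 0 S
  with-zero S = does-⇔ (suc ∣ S ∣ ≤? 1) (∣ S ∣ ≤? 0) (λ { (s≤s ≤0) → ≤0 }) s≤s

module _ {m} {𝓕 : Family (suc m)} (np : NoShatteredPair 𝓕) (full : UnionFull 𝓕) (empty : InterEmpty 𝓕) where

  count-Sh : count (Sh 𝓕) ≡ suc (suc m)
  count-Sh = trans (count-cong _ _ Sh≡SizeAtMost1) (count-size≤1 (suc m))
    where
    Sh≡SizeAtMost1 : ∀ S → Sh 𝓕 S ≡ SizeAtMost 1 S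
    Sh≡SizeAtMost1 S = does-⇔ (shatters? 𝓕 S) (∣ S ∣ ≤? 1) (noPair⇒vc≤1 np S) (small-shattered full empty S)

  maximum⇒admissible : count 𝓕 ≡ suc (suc m) → Admissible 𝓕
  maximum⇒admissible |𝓕| =
    trans count-Sh (sym |𝓕|) ,
    ((⁅ zero ⁆ , small-shattered full empty ⁅ zero ⁆ (≤-reflexive ∣⁅0⁆∣≡1) , ∣⁅0⁆∣≡1)
     , noPair⇒vc≤1 np) ,
    full , empty
    where
    ∣⁅0⁆∣≡1 : ∣ ⁅ zero {m} ⁆ ∣ ≡ 1
    ∣⁅0⁆∣≡1 = ∣⁅x⁆∣≡1 (zero {m})

admissible⇒maximum : ∀ {m} {𝓕 : Family (suc m)} → Admissible 𝓕 →
                     NoShatteredPair 𝓕 × count 𝓕 ≡ suc (suc m)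
admissible⇒maximum (s-extremal , (_ , vc≤1) , full , empty) =
  np , trans (sym s-extremal) (count-Sh np full empty)
  where np = vc≤1⇒noPair vc≤1

other-value : ∀ {x y z : Bool} → x ≢ y → z ≢ x → z ≡ y
other-value x≢y z≢x = trans (¬-not z≢x) (sym (¬-not (x≢y ∘ sym)))

one-of : ∀ {x y : Bool} → x ≢ y → ∀ z → z ≡ x ⊎ z ≡ y
one-of {x} x≢y z with z Bool.≟ x
... | yes z≡x = inj₁ z≡x
... | no  z≢x = inj₂ (other-value x≢y z≢x)

-- If 𝓕 shatters no
-- pair then Z = P or Y = P: otherwise some {0, l} would be shattered.
twin-adjacent : ∀ {m} {𝓕 : Family (suc m)} → NoShatteredPair 𝓕 → ∀ {P Z Y z y k} →
                (∀ x → (x ∷ P) ∈𝓕 𝓕) → (z ∷ Z) ∈𝓕 𝓕 → (y ∷ Y) ∈𝓕 𝓕 → z ≢ y →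
                Z ─[ k ]─ Y → Z ≡ P ⊎ Y ≡ P
twin-adjacent {𝓕 = 𝓕} np {P} {Z} {Y} {z} {y} {k} twin z∷Z∈ y∷Y∈ z≢y Z─Y =
  decide (lookup Z k Bool.≟ lookup P k)
  where
  Z≈P : ∀ l → l ≢ k → lookup Z l ≡ lookup P l
  Z≈P l l≢k with lookup Z l Bool.≟ lookup P l
  ... | yes Zl≡Pl = Zl≡Pl
  ... | no  Zl≢Pl = ⊥-elim (np zero (suc l) (λ ()) shattered)
    where
    shattered : ShattersPair 𝓕 zero (suc l)
    shattered p q with one-of Zl≢Pl q
    ... | inj₂ q≡Pl = p ∷ P , twin p , refl , sym q≡Pl
    ... | inj₁ q≡Zl with one-of z≢y p
    ...   | inj₁ p≡z = z ∷ Z , z∷Z∈ , sym p≡z , sym q≡Zl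
    ...   | inj₂ p≡y = y ∷ Y , y∷Y∈ , sym p≡y , trans (sym (adjacent-agree Z─Y l l≢k)) (sym q≡Zl)

  Y≈P : ∀ l → l ≢ k → lookup Y l ≡ lookup P l
  Y≈P l l≢k = trans (sym (adjacent-agree Z─Y l l≢k)) (Z≈P l l≢k)

  agree-everywhere : ∀ X → (∀ l → l ≢ k → lookup X l ≡ lookup P l) → lookup X k ≡ lookup P k →
                     ∀ l → lookup X l ≡ lookup P l
  agree-everywhere X off at l with l ≟ k
  ... | yes refl = at
  ... | no  l≢k  = off l l≢k

  -- at k, one of Z, Y agrees with P since they differ there
  decide : Dec (lookup Z k ≡ lookup P k) → Z ≡ P ⊎ Y ≡ P
  decide (yes Zk≡Pk) = inj₁ (subset-ext (agree-everywhere Z Z≈P Zk≡Pk))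
  decide (no  Zk≢Pk) = inj₂ (subset-ext (agree-everywhere Y Y≈P
                         (sym (other-value (adjacent-differ Z─Y) (Zk≢Pk ∘ sym)))))

tight-sum : ∀ {a b m} → a + b ≡ suc (suc m) → a ≤ suc m → b ≤ 1 → a ≡ suc m × b ≡ 1
tight-sum {a} {zero}     eq a≤ _ rewrite +-identityʳ a | eq = ⊥-elim (1+n≰n a≤)
tight-sum {a} {suc zero} eq _  _ rewrite +-suc a 0 | +-identityʳ a = suc-injective eq , refl
tight-sum {b = suc (suc _)} _ _ (s≤s ())

-- By induction on m: the shadow again has maximum size,
-- so it is connected, and 𝓕 has exactly one twin P.  A path in the shadow
-- lifts to 𝓕; where the first coordinate must change, twin-adjacent shows
-- the path passes through P, and the edge 0∷P — 1∷P flips it.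
maximum⇒connected : ∀ {m} (𝓕 : Family m) → NoShatteredPair 𝓕 → count 𝓕 ≡ suc m → Connected 𝓕
maximum⇒connected {zero} 𝓕 _ _ [] [] _ _ = start
maximum⇒connected {suc m} 𝓕 np |𝓕| (x ∷ a) (y ∷ b) x∷a∈ y∷b∈ =
  lift (maximum⇒connected (shadow 𝓕) (shadow-noPair 𝓕 np) (proj₁ sizes) a b
                          (member-shadow 𝓕 x∷a∈) (member-shadow 𝓕 y∷b∈)) x∷a∈ y∷b∈
  where
  sizes : count (shadow 𝓕) ≡ suc m × count (twins 𝓕) ≡ 1
  sizes = tight-sum (trans (sym (count-shadow+twins 𝓕)) |𝓕|)
                    (sauer₁ (shadow 𝓕) (shadow-noPair 𝓕 np)) (sauer₀ (twins 𝓕) (twins-noPoint 𝓕 np))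

  twin-witness : ∃[ P ] (P ∈𝓕 twins 𝓕)
  twin-witness = some-member (twins 𝓕) (subst (0 <_) (sym (proj₂ sizes)) (s≤s z≤n))

  P : Subset m
  P = proj₁ twin-witness

  twin : ∀ x → (x ∷ P) ∈𝓕 𝓕
  twin = twins-member 𝓕 (proj₂ twin-witness)

  retarget : ∀ {S Y} z y → Path 𝓕 S (z ∷ Y) → (y ∷ Y) ∈𝓕 𝓕 → Path 𝓕 S (y ∷ Y)
  retarget true  true  w _  = w
  retarget false false w _  = w
  retarget true  false w y∈ = step zero w (inj₂ (edge-head _)) y∈
  retarget false true  w y∈ = step zero w (inj₁ (edge-head _)) y∈

  -- lift the last step Z ─ Y of a shadow path, arriving at z∷Z: keep the
  -- first coordinate if z = y; otherwise Z = P (move to y∷P first) or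
  -- Y = P (step to z∷P, then flip)
  lift : ∀ {X Y x y} → Path (shadow 𝓕) X Y → (x ∷ X) ∈𝓕 𝓕 → (y ∷ Y) ∈𝓕 𝓕 → Path 𝓕 (x ∷ X) (y ∷ Y)
  lift {x = x} {y} start _ y∷Y∈ = retarget x y start y∷Y∈
  lift {y = y} (step k w Z─Y _) x∷X∈ y∷Y∈ with shadow-member 𝓕 (path-end (member-shadow 𝓕 x∷X∈) w)
  ... | z , z∷Z∈ with z Bool.≟ y
  ... | yes refl = step (suc k) (lift w x∷X∈ z∷Z∈) (adjacent-cons z Z─Y) y∷Y∈
  ... | no z≢y with twin-adjacent {𝓕 = 𝓕} np twin z∷Z∈ y∷Y∈ z≢y Z─Y
  ... | inj₁ refl = step (suc k) (lift w x∷X∈ (twin y)) (adjacent-cons y Z─Y) y∷Y∈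
  ... | inj₂ refl = retarget z y (step (suc k) (lift w x∷X∈ z∷Z∈) (adjacent-cons z Z─Y) (twin z)) y∷Y∈

EdgeLabelled : ∀ {m} → Family m → Fin m → Set
EdgeLabelled 𝓕 j = ∃[ G ] ∃[ H ] (G ∈𝓕 𝓕 × H ∈𝓕 𝓕 × G ─[ j ]→ H)

adjacent-upwards : ∀ {m} {b c : Subset m} {j} → lookup b j ≡ false → b ─[ j ]─ c → b ─[ j ]→ c
adjacent-upwards bj (inj₁ b→c) = b→c
adjacent-upwards bj (inj₂ c→b) = ⊥-elim (true≢false (trans (sym (edge-target c→b)) bj))

crossing-edge : ∀ {m} {𝓕 : Family m} j {a b} → Path 𝓕 a b → a ∈𝓕 𝓕 →
                lookup a j ≡ false → lookup b j ≡ true → EdgeLabelled 𝓕 j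
crossing-edge j start a∈ aj bj = ⊥-elim (true≢false (trans (sym bj) aj))
crossing-edge j (step {b} {c} k w b─c c∈) a∈ aj cj with lookup b j in bj
... | true  = crossing-edge j w a∈ aj bj
... | false with k ≟ j
...   | yes refl = b , c , path-end a∈ w , c∈ , adjacent-upwards bj b─c
...   | no  k≢j  = ⊥-elim (true≢false (trans (sym cj) (trans (sym (adjacent-agree b─c j (k≢j ∘ sym))) bj)))

-- if 𝓕 shatters no pair, all its edges labelled j have the same lower end:
-- two lower ends G, G′ differing at l would make {j, l} shattered
unique-edge : ∀ {m} {𝓕 : Family m} → NoShatteredPair 𝓕 → ∀ {j G H G′ H′} →
              G ∈𝓕 𝓕 → H ∈𝓕 𝓕 → G ─[ j ]→ H → G′ ∈𝓕 𝓕 → H′ ∈𝓕 𝓕 → G′ ─[ j ]→ H′ → G ≡ G′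
unique-edge {𝓕 = 𝓕} np {j} {G} {H} {G′} {H′} G∈ H∈ G→H G′∈ H′∈ G′→H′ = subset-ext agree
  where
  agree : ∀ l → lookup G l ≡ lookup G′ l
  agree l with l ≟ j
  ... | yes refl = trans (edge-source G→H) (sym (edge-source G′→H′))
  ... | no  l≢j with lookup G l Bool.≟ lookup G′ l
  ...   | yes Gl≡G′l = Gl≡G′l
  ...   | no  Gl≢G′l = ⊥-elim (np j l (l≢j ∘ sym) shattered)
    where
    shattered : ShattersPair 𝓕 j l
    shattered true  q with one-of Gl≢G′l q
    ... | inj₁ q≡Gl  = H  , H∈  , edge-target G→H   , trans (edge-other G→H l l≢j) (sym q≡Gl)
    ... | inj₂ q≡G′l = H′ , H′∈ , edge-target G′→H′ , trans (edge-other G′→H′ l l≢j) (sym q≡G′l)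
    shattered false q with one-of Gl≢G′l q
    ... | inj₁ q≡Gl  = G  , G∈  , edge-source G→H   , sym q≡Gl
    ... | inj₂ q≡G′l = G′ , G′∈ , edge-source G′→H′ , sym q≡G′l

module Isomorphism {n} {𝓕 : Family n} {T : LGraph n} (iso : 𝓕 ≅G T) where
  open _≅G_ iso

  edge-of-label : ∀ j → φ (src T j) ─[ j ]→ φ (tgt T j)
  edge-of-label j = proj₁ (edges _ _ j) (refl , refl)

  label-of-edge : ∀ {u v j} → φ u ─[ j ]→ φ v → src T j ≡ u × tgt T j ≡ v
  label-of-edge {u} {v} {j} = proj₂ (edges u v j)

  path⇒walk : ∀ {u a} → Path 𝓕 (φ u) a → ∀ v → φ v ≡ a → Walk T (λ _ → ⊤) u v
  path⇒walk start v φv≡φu = subst (Walk T _ _) (φ-inj _ v (sym φv≡φu)) stay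
  path⇒walk {u} (step {b} j w b─c _) v refl with φ-onto b (path-end (φ-into u) w)
  ... | _ , refl with b─c
  ...   | inj₁ b→c with label-of-edge b→c
  ...     | refl , refl = fwd j tt (path⇒walk w _ refl)
  path⇒walk {u} (step {b} j w b─c _) v refl | _ , refl | inj₂ c→b with label-of-edge c→b
  ...     | refl , refl = bwd j tt (path⇒walk w _ refl)

  constant-off : ∀ {A u v} j → (∀ k → A k → k ≢ j) → Walk T A u v → lookup (φ u) j ≡ lookup (φ v) j
  constant-off j avoid stay        = refl
  constant-off j avoid (fwd k a w) =
    trans (constant-off j avoid w) (sym (edge-other (edge-of-label k) j (avoid k a ∘ sym)))
  constant-off j avoid (bwd k a w) =
    trans (constant-off j avoid w) (edge-other (edge-of-label k) j (avoid k a ∘ sym))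

  -- hence every edge of T is a bridge, as coordinate j changes along it
  bridges : ∀ j → ¬ Walk T (λ k → k ≢ j) (src T j) (tgt T j)
  bridges j w = true≢false (trans (sym (edge-target (edge-of-label j)))
                           (trans (sym (constant-off j (λ _ k≢j → k≢j) w)) (edge-source (edge-of-label j))))

  connected⇒tree : Connected 𝓕 → IsTree T
  connected⇒tree conn = (λ u v → path⇒walk (conn _ _ (φ-into u) (φ-into v)) v refl) , bridges

-- Two families isomorphic to the same connected T coincide: following a
-- walk from src j, coordinate j of the vertex sets is forced (false at src j,
-- switching exactly along edges labelled j).
isomorphic-families-agree : ∀ {n} {𝓕 𝓕′ : Family n} {T} → 𝓕 ≅G T → 𝓕′ ≅G T →
                            (∀ u v → Walk T (λ _ → ⊤) u v) → ∀ G → 𝓕 G ≡ 𝓕′ G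
isomorphic-families-agree {𝓕 = 𝓕} {𝓕′} {T} iso iso′ conn G =
  ⇔→≡ {z = true} (mk⇔ (transfer iso iso′ same-sets) (transfer iso′ iso (sym ∘ same-sets)))
  where
  open _≅G_ iso using (φ)
  open _≅G_ iso′ using () renaming (φ to φ′)
  module I = Isomorphism iso
  module I′ = Isomorphism iso′

  agree : ∀ j {u} → Walk T (λ _ → ⊤) (src T j) u → lookup (φ u) j ≡ lookup (φ′ u) j
  agree j stay = trans (edge-source (I.edge-of-label j)) (sym (edge-source (I′.edge-of-label j)))
  agree j (fwd k _ w) with k ≟ j
  ... | yes refl = trans (edge-target (I.edge-of-label k)) (sym (edge-target (I′.edge-of-label k)))
  ... | no  k≢j  = trans (edge-other (I.edge-of-label k) j (k≢j ∘ sym))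
                   (trans (agree j w) (sym (edge-other (I′.edge-of-label k) j (k≢j ∘ sym))))
  agree j (bwd k _ w) with k ≟ j
  ... | yes refl = trans (edge-source (I.edge-of-label k)) (sym (edge-source (I′.edge-of-label k)))
  ... | no  k≢j  = trans (sym (edge-other (I.edge-of-label k) j (k≢j ∘ sym)))
                   (trans (agree j w) (edge-other (I′.edge-of-label k) j (k≢j ∘ sym)))

  same-sets : ∀ u → φ u ≡ φ′ u
  same-sets u = subset-ext λ j → agree j (conn (src T j) u)

  transfer : ∀ {𝓖 𝓖′ : Family _} (i : 𝓖 ≅G T) (i′ : 𝓖′ ≅G T) →
             (∀ u → _≅G_.φ i u ≡ _≅G_.φ i′ u) → G ∈𝓕 𝓖 → G ∈𝓕 𝓖′
  transfer {𝓖′ = 𝓖′} i i′ eq G∈ with _≅G_.φ-onto i G G∈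
  ... | u , refl = subst (λ X → X ∈𝓕 𝓖′) (sym (eq u)) (_≅G_.φ-into i′ u)

-- For 𝓕 shattering no pair, with connected G_𝓕, ⋃𝓕 = [n], ⋂𝓕 = ∅ and an
-- enumeration by n+1 vertices, G_𝓕 is isomorphic to a labelled graph T
-- with one edge per label: the edge labelled j exists by crossing-edge
-- (walk from a set without j to one with j) and is unique by unique-edge.
module InclusionGraph {n} (𝓕 : Family n) (np : NoShatteredPair 𝓕) (conn : Connected 𝓕)
                      (full : UnionFull 𝓕) (empty : InterEmpty 𝓕) (enum : Enumeration 𝓕 (suc n)) where
  open Enumeration enum

  the-edge : ∀ j → EdgeLabelled 𝓕 j
  the-edge j = let (a , a∈ , j∉a) = empty j ; (b , b∈ , j∈b) = full j in
               crossing-edge j (conn a b a∈ b∈) a∈ (∉⇒false j∉a) (∈⇒true j∈b)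

  lower upper : Fin n → Subset n
  lower j = proj₁ (the-edge j)
  upper j = proj₁ (proj₂ (the-edge j))

  lower∈ : ∀ j → lower j ∈𝓕 𝓕
  lower∈ j = proj₁ (proj₂ (proj₂ (the-edge j)))

  upper∈ : ∀ j → upper j ∈𝓕 𝓕
  upper∈ j = proj₁ (proj₂ (proj₂ (proj₂ (the-edge j))))

  lower→upper : ∀ j → lower j ─[ j ]→ upper j
  lower→upper j = proj₂ (proj₂ (proj₂ (proj₂ (the-edge j))))

  T : LGraph n
  T = record { src = λ j → proj₁ (φ-onto (lower j) (lower∈ j))
             ; tgt = λ j → proj₁ (φ-onto (upper j) (upper∈ j)) }

  φ-src : ∀ j → φ (src T j) ≡ lower j
  φ-src j = proj₂ (φ-onto (lower j) (lower∈ j))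

  φ-tgt : ∀ j → φ (tgt T j) ≡ upper j
  φ-tgt j = proj₂ (φ-onto (upper j) (upper∈ j))

  edge⇒label : ∀ {u v j} → φ u ─[ j ]→ φ v → src T j ≡ u × tgt T j ≡ v
  edge⇒label {u} {v} {j} u→v = φ-inj _ _ (trans (φ-src j) lower≡φu) , φ-inj _ _ (begin
    φ (tgt T j)        ≡⟨ φ-tgt j ⟩
    upper j            ≡⟨ proj₂ (lower→upper j) ⟩
    lower j ∪ ⁅ j ⁆    ≡⟨ cong (_∪ ⁅ j ⁆) lower≡φu ⟩
    φ u ∪ ⁅ j ⁆        ≡⟨ sym (proj₂ u→v) ⟩
    φ v                ∎)
    where
    open ≡-Reasoning
    lower≡φu : lower j ≡ φ u
    lower≡φu = unique-edge np (lower∈ j) (upper∈ j) (lower→upper j) (φ-into u) (φ-into v) u→v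

  label⇒edge : ∀ {u v j} → src T j ≡ u × tgt T j ≡ v → φ u ─[ j ]→ φ v
  label⇒edge {j = j} (refl , refl) =
    subst₂ (λ X Y → X ─[ j ]→ Y) (sym (φ-src j)) (sym (φ-tgt j)) (lower→upper j)

  iso : 𝓕 ≅G T
  iso = record { φ = φ ; φ-inj = φ-inj ; φ-into = φ-into ; φ-onto = φ-onto
               ; edges = λ u v j → label⇒edge , edge⇒label }

module Walks {n} (T : LGraph n) where

  weaken : ∀ {A B : Fin n → Set} {u v} → (∀ k → A k → B k) → Walk T A u v → Walk T B u v
  weaken A⇒B stay        = stay
  weaken A⇒B (fwd j a w) = fwd j (A⇒B j a) (weaken A⇒B w)
  weaken A⇒B (bwd j a w) = bwd j (A⇒B j a) (weaken A⇒B w)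

  _++_ : ∀ {A u v w} → Walk T A u v → Walk T A v w → Walk T A u w
  w ++ stay        = w
  w ++ fwd j a w′  = fwd j a (w ++ w′)
  w ++ bwd j a w′  = bwd j a (w ++ w′)

  reverse : ∀ {A u v} → Walk T A u v → Walk T A v u
  reverse stay        = stay
  reverse (fwd j a w) = bwd j a stay ++ reverse w
  reverse (bwd j a w) = fwd j a stay ++ reverse w

  no-labels : ∀ {A u v} → (∀ j → ¬ A j) → Walk T A u v → u ≡ v
  no-labels none stay        = refl
  no-labels none (fwd j a _) = ⊥-elim (none j a)
  no-labels none (bwd j a _) = ⊥-elim (none j a)

  Endpoint : Fin n → Fin (suc n) → Set
  Endpoint j x = x ≡ src T j ⊎ x ≡ tgt T j

  one-label : ∀ {j u v} → Walk T (_≡ j) u v → u ≡ v ⊎ (Endpoint j u × Endpoint j v)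
  one-label stay = inj₁ refl
  one-label (fwd _ refl w) with one-label w
  ... | inj₁ refl      = inj₂ (inj₁ refl , inj₂ refl)
  ... | inj₂ (end , _) = inj₂ (end , inj₂ refl)
  one-label (bwd _ refl w) with one-label w
  ... | inj₁ refl      = inj₂ (inj₂ refl , inj₁ refl)
  ... | inj₂ (end , _) = inj₂ (end , inj₁ refl)

  _∖_ : (Fin n → Set) → Fin n → Fin n → Set
  (A ∖ k) j = A j × j ≢ k

  last-crossing : ∀ k {A u v} → Walk T A u v →
    Walk T (A ∖ k) u v ⊎ (Walk T (A ∖ k) (src T k) v ⊎ Walk T (A ∖ k) (tgt T k) v)
  last-crossing k stay = inj₁ stay
  last-crossing k (fwd j a w) with j ≟ k
  ... | yes refl = inj₂ (inj₂ stay)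
  ... | no  j≢k with last-crossing k w
  ...   | inj₁ w′        = inj₁ (fwd j (a , j≢k) w′)
  ...   | inj₂ (inj₁ w′) = inj₂ (inj₁ (fwd j (a , j≢k) w′))
  ...   | inj₂ (inj₂ w′) = inj₂ (inj₂ (fwd j (a , j≢k) w′))
  last-crossing k (bwd j a w) with j ≟ k
  ... | yes refl = inj₂ (inj₁ stay)
  ... | no  j≢k with last-crossing k w
  ...   | inj₁ w′        = inj₁ (bwd j (a , j≢k) w′)
  ...   | inj₂ (inj₁ w′) = inj₂ (inj₁ (bwd j (a , j≢k) w′))
  ...   | inj₂ (inj₂ w′) = inj₂ (inj₂ (bwd j (a , j≢k) w′))

  first-crossing : ∀ k {A u v} → Walk T A u v →
    Walk T (A ∖ k) u v ⊎ (Walk T (A ∖ k) u (src T k) ⊎ Walk T (A ∖ k) u (tgt T k))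
  first-crossing k w with last-crossing k (reverse w)
  ... | inj₁ w′        = inj₁ (reverse w′)
  ... | inj₂ (inj₁ w′) = inj₂ (inj₁ (reverse w′))
  ... | inj₂ (inj₂ w′) = inj₂ (inj₂ (reverse w′))

-- The family of a labelled tree T: label j is put into the set of vertex
-- v iff v lies on the tgt-side of the edge j, i.e. v can be reached from
-- tgt j (rather than from src j) without using the edge j.
module TreeFamily {n} (T : LGraph n) (tree : IsTree T) where
  open Walks T

  private
    connected : ∀ u v → Walk T (λ _ → ⊤) u v
    connected = proj₁ tree
    bridge : ∀ j → ¬ Walk T (λ k → k ≢ j) (src T j) (tgt T j)
    bridge = proj₂ tree

  Avoiding : Fin n → Fin (suc n) → Fin (suc n) → Set
  Avoiding j = Walk T (λ k → k ≢ j)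

  avoids : ∀ {A k x y} → Walk T (A ∖ k) x y → Avoiding k x y
  avoids = weaken (λ _ → proj₂)

  unrestrict : ∀ {A k x y} → Walk T (A ∖ k) x y → Walk T A x y
  unrestrict = weaken (λ _ → proj₁)

  leave : ∀ j {A v} → Walk T A (src T j) v → Avoiding j (src T j) v ⊎ Avoiding j (tgt T j) v
  leave j stay = inj₁ stay
  leave j (fwd k _ w) with k ≟ j
  ... | yes refl = inj₂ stay
  ... | no  k≢j  = map (fwd k k≢j) (fwd k k≢j) (leave j w)
  leave j (bwd k _ w) with k ≟ j
  ... | yes refl = inj₁ stay
  ... | no  k≢j  = map (bwd k k≢j) (bwd k k≢j) (leave j w)

  side : Fin n → Fin (suc n) → Bool
  side j v = [ (λ _ → false) , (λ _ → true) ]′ (leave j (connected (src T j) v))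

  both-ends : ∀ {j v} → Avoiding j (src T j) v → Avoiding j (tgt T j) v → ⊥
  both-ends {j} from-src from-tgt = bridge j (from-src ++ reverse from-tgt)

  side-false : ∀ {j v} → Avoiding j (src T j) v → side j v ≡ false
  side-false {j} {v} from-src with leave j (connected (src T j) v)
  ... | inj₁ _        = refl
  ... | inj₂ from-tgt = ⊥-elim (both-ends from-src from-tgt)

  side-true : ∀ {j v} → Avoiding j (tgt T j) v → side j v ≡ true
  side-true {j} {v} from-tgt with leave j (connected (src T j) v)
  ... | inj₂ _        = refl
  ... | inj₁ from-src = ⊥-elim (both-ends from-src from-tgt)

  reach : ∀ j v → (Avoiding j (src T j) v × side j v ≡ false) ⊎ (Avoiding j (tgt T j) v × side j v ≡ true)
  reach j v with leave j (connected (src T j) v)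
  ... | inj₁ w = inj₁ (w , refl)
  ... | inj₂ w = inj₂ (w , refl)

  side-invariant : ∀ {j x y} → Avoiding j x y → side j x ≡ side j y
  side-invariant {j} {x} w with reach j x
  ... | inj₁ (w′ , eq) = trans eq (sym (side-false (w′ ++ w)))
  ... | inj₂ (w′ , eq) = trans eq (sym (side-true (w′ ++ w)))

  same-side : ∀ {j x y} → side j x ≡ side j y → Avoiding j x y
  same-side {j} {x} {y} eq with reach j x | reach j y
  ... | inj₁ (wx , _)  | inj₁ (wy , _)  = reverse wx ++ wy
  ... | inj₂ (wx , _)  | inj₂ (wy , _)  = reverse wx ++ wy
  ... | inj₁ (_ , sx) | inj₂ (_ , sy) = ⊥-elim (true≢false (trans (sym sy) (trans (sym eq) sx)))
  ... | inj₂ (_ , sx) | inj₁ (_ , sy) = ⊥-elim (true≢false (trans (sym sx) (trans eq sy)))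

  side-src : ∀ j → side j (src T j) ≡ false
  side-src j = side-false stay

  side-tgt : ∀ j → side j (tgt T j) ≡ true
  side-tgt j = side-true stay

  side-along : ∀ {j l} → j ≢ l → side l (src T j) ≡ side l (tgt T j)
  side-along j≢l = side-invariant (fwd _ j≢l stay)

  Separates : Fin (suc n) → Fin (suc n) → Fin n → Set
  Separates u v j = side j u ≢ side j v

  -- a label not separating u and v can be dropped from any walk between
  -- them: join the parts before its first and after its last use
  drop-label : ∀ {A u v} k → side k u ≡ side k v → Walk T A u v → Walk T (A ∖ k) u v
  drop-label {u = u} {v} k eq w with first-crossing k w | last-crossing k w
  ... | inj₁ w′        | _              = w′
  ... | inj₂ _         | inj₁ w′        = w′
  ... | inj₂ (inj₁ w₁) | inj₂ (inj₁ w₂) = w₁ ++ w₂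
  ... | inj₂ (inj₂ w₁) | inj₂ (inj₂ w₂) = w₁ ++ w₂
  ... | inj₂ (inj₁ w₁) | inj₂ (inj₂ w₂) = ⊥-elim (true≢false (begin
    true       ≡⟨ sym (side-true (avoids w₂)) ⟩
    side k v   ≡⟨ sym eq ⟩
    side k u   ≡⟨ side-false (reverse (avoids w₁)) ⟩
    false      ∎))
    where open ≡-Reasoning
  ... | inj₂ (inj₂ w₁) | inj₂ (inj₁ w₂) = ⊥-elim (true≢false (begin
    true       ≡⟨ sym (side-true (reverse (avoids w₁))) ⟩
    side k u   ≡⟨ eq ⟩
    side k v   ≡⟨ side-false (avoids w₂) ⟩
    false      ∎))
    where open ≡-Reasoning

  -- dropping the non-separating labels one by one, any two vertices are
  -- joined by a walk using separating labels only
  separating-walk : ∀ u v → Walk T (Separates u v) u v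
  separating-walk u v = prune (allFin n) (weaken (λ j _ → inj₁ (∈-allFin j)) (connected u v))
    where
    Allowed : List (Fin n) → Fin n → Set
    Allowed ks j = j ∈ₗ ks ⊎ Separates u v j

    prune-one : ∀ k ks → Walk T (Allowed (k ∷ ks)) u v → Walk T (Allowed ks) u v
    prune-one k ks w with side k u Bool.≟ side k v
    ... | no  k-separates = weaken keep w
      where
      keep : ∀ j → Allowed (k ∷ ks) j → Allowed ks j
      keep j (inj₁ (hereₗ refl))  = inj₂ k-separates
      keep j (inj₁ (thereₗ j∈ks)) = inj₁ j∈ks
      keep j (inj₂ sep)          = inj₂ sep
    ... | yes same-k = weaken keep (drop-label k same-k w)
      where
      keep : ∀ j → (Allowed (k ∷ ks) ∖ k) j → Allowed ks j
      keep j (inj₁ (hereₗ refl) , j≢k) = ⊥-elim (j≢k refl)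
      keep j (inj₁ (thereₗ j∈ks) , _)  = inj₁ j∈ks
      keep j (inj₂ sep , _)           = inj₂ sep

    prune : ∀ ks → Walk T (Allowed ks) u v → Walk T (Separates u v) u v
    prune []       = weaken (λ j → [ (λ ()) , (λ sep → sep) ]′)
    prune (k ∷ ks) = prune ks ∘ prune-one k ks

  φ : Fin (suc n) → Subset n
  φ v = tabulate (λ j → side j v)

  lookup-φ : ∀ v j → lookup (φ v) j ≡ side j v
  lookup-φ v j = lookup∘tabulate (λ j → side j v) j

  -- distinct vertices are separated by some label
  φ-inj : ∀ u v → φ u ≡ φ v → u ≡ v
  φ-inj u v φu≡φv = no-labels (λ j sep → sep (begin
    side j u       ≡⟨ sym (lookup-φ u j) ⟩
    lookup (φ u) j ≡⟨ cong (λ X → lookup X j) φu≡φv ⟩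
    lookup (φ v) j ≡⟨ lookup-φ v j ⟩
    side j v       ∎)) (separating-walk u v)
    where open ≡-Reasoning

  𝓕 : Family n
  𝓕 G = does (FinP.any? (λ v → ≡-dec Bool._≟_ (φ v) G))

  φ-into : ∀ u → φ u ∈𝓕 𝓕
  φ-into u = dec-true (FinP.any? (λ v → ≡-dec Bool._≟_ (φ v) (φ u))) (u , refl)

  φ-onto : ∀ G → G ∈𝓕 𝓕 → ∃[ u ] (φ u ≡ G)
  φ-onto G = does⇒proof (FinP.any? (λ v → ≡-dec Bool._≟_ (φ v) G))

  enumeration : Enumeration 𝓕 (suc n)
  enumeration = record { φ = φ ; φ-inj = φ-inj ; φ-into = φ-into ; φ-onto = φ-onto }

  label⇒edge : ∀ {u v j} → src T j ≡ u × tgt T j ≡ v → φ u ─[ j ]→ φ v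
  label⇒edge {j = j} (refl , refl) = edge-intro
    (trans (lookup-φ _ j) (side-src j))
    (trans (lookup-φ _ j) (side-tgt j))
    (λ l l≢j → trans (lookup-φ _ l) (trans (sym (side-along (l≢j ∘ sym))) (sym (lookup-φ _ l))))

  edge⇒label : ∀ {u v j} → φ u ─[ j ]→ φ v → src T j ≡ u × tgt T j ≡ v
  edge⇒label {u} {v} {j} u→v = ends (one-label (weaken only-j (separating-walk u v)))
    where
    side-u : side j u ≡ false
    side-u = trans (sym (lookup-φ u j)) (edge-source u→v)
    side-v : side j v ≡ true
    side-v = trans (sym (lookup-φ v j)) (edge-target u→v)
    only-j : ∀ l → Separates u v l → l ≡ j
    only-j l sep with l ≟ j
    ... | yes l≡j = l≡j
    ... | no  l≢j = ⊥-elim (sep (trans (sym (lookup-φ u l)) (trans (sym (edge-other u→v l l≢j)) (lookup-φ v l))))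
    ends : u ≡ v ⊎ (Endpoint j u × Endpoint j v) → src T j ≡ u × tgt T j ≡ v
    ends (inj₁ refl)               = ⊥-elim (true≢false (trans (sym side-v) side-u))
    ends (inj₂ (inj₂ refl , _))    = ⊥-elim (true≢false (trans (sym (side-tgt j)) side-u))
    ends (inj₂ (_ , inj₁ refl))    = ⊥-elim (true≢false (trans (sym side-v) (side-src j)))
    ends (inj₂ (inj₁ refl , inj₂ refl)) = refl , refl

  iso : 𝓕 ≅G T
  iso = record { φ = φ ; φ-inj = φ-inj ; φ-into = φ-into ; φ-onto = φ-onto
               ; edges = λ u v j → label⇒edge , edge⇒label }

  -- ⋃𝓕 = [n] and ⋂𝓕 = ∅: label i lies in the set of tgt i but not of src i
  full : UnionFull 𝓕
  full i = φ (tgt T i) , φ-into _ , true⇒∈ (trans (lookup-φ _ i) (side-tgt i))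

  empty : InterEmpty 𝓕
  empty i = φ (src T i) , φ-into _ , false⇒∉ (trans (lookup-φ _ i) (side-src i))

  -- 𝓕 shatters no pair {i, j}: take x, y on the side of i opposite to
  -- src j, with x on the src-side and y on the tgt-side of j.  A walk from
  -- x to y avoiding i must cross j, which would put src j (and tgt j)
  -- on the side of y of i.
  no-pair : NoShatteredPair 𝓕
  no-pair i j i≢j sh = crossing (last-crossing j (same-side (trans xi (sym yi))))
    where
    s : Bool
    s = side i (src T j)

    vertex : ∀ p q → ∃[ v ] (side i v ≡ p × side j v ≡ q)
    vertex p q =
      let (G , G∈ , Gi , Gj) = sh p q ; (v , φv≡G) = φ-onto G G∈
          at : ∀ l → side l v ≡ lookup G l
          at l = trans (sym (lookup-φ v l)) (cong (λ X → lookup X l) φv≡G)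
      in v , trans (at i) Gi , trans (at j) Gj

    x y : Fin (suc n)
    x = proj₁ (vertex (not s) false)
    y = proj₁ (vertex (not s) true)
    xi : side i x ≡ not s
    xi = proj₁ (proj₂ (vertex (not s) false))
    xj : side j x ≡ false
    xj = proj₂ (proj₂ (vertex (not s) false))
    yi : side i y ≡ not s
    yi = proj₁ (proj₂ (vertex (not s) true))
    yj : side j y ≡ true
    yj = proj₂ (proj₂ (vertex (not s) true))

    crossing : Walk T ((λ k → k ≢ i) ∖ j) x y ⊎ (Walk T ((λ k → k ≢ i) ∖ j) (src T j) y
                                                ⊎ Walk T ((λ k → k ≢ i) ∖ j) (tgt T j) y) → ⊥
    crossing (inj₁ w)        = true≢false (trans (sym yj) (trans (sym (side-invariant (avoids w))) xj))
    crossing (inj₂ (inj₁ w)) = not-¬ refl (trans (side-invariant (unrestrict w)) yi)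
    crossing (inj₂ (inj₂ w)) = not-¬ refl (trans (side-along (i≢j ∘ sym))
                                           (trans (side-invariant (unrestrict w)) yi))

family⇒tree : ∀ {m} (𝓕 : Family (suc m)) → Admissible 𝓕 → ∃[ T ] (IsTree T × 𝓕 ≅G T)
family⇒tree {m} 𝓕 adm@(_ , _ , full , empty) =
  T , Isomorphism.connected⇒tree iso connected , iso
  where
  np : NoShatteredPair 𝓕
  np = proj₁ (admissible⇒maximum adm)
  size : count 𝓕 ≡ suc (suc m)
  size = proj₂ (admissible⇒maximum adm)
  connected : Connected 𝓕
  connected = maximum⇒connected 𝓕 np size
  open InclusionGraph 𝓕 np connected full empty (count⇒enumeration 𝓕 size)

graph-determines-family : ∀ {m} (𝓕 𝓕′ : Family (suc m)) (T : LGraph (suc m)) → Admissible 𝓕 →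
                          𝓕 ≅G T → 𝓕′ ≅G T → ∀ G → 𝓕 G ≡ 𝓕′ G
graph-determines-family 𝓕 𝓕′ T adm iso iso′ = isomorphic-families-agree iso iso′ walks
  where
  connected : Connected 𝓕
  connected = maximum⇒connected 𝓕 (proj₁ (admissible⇒maximum adm)) (proj₂ (admissible⇒maximum adm))
  walks : ∀ u v → Walk T (λ _ → ⊤) u v
  walks = proj₁ (Isomorphism.connected⇒tree iso connected)

tree⇒family : ∀ {m} (T : LGraph (suc m)) → IsTree T → ∃[ 𝓕 ] (Admissible 𝓕 × 𝓕 ≅G T)
tree⇒family T tree =
  𝓕 , maximum⇒admissible no-pair full empty (enumeration⇒count enumeration) , iso
  where open TreeFamily T tree

mainTheorem2 : ∀ (n : ℕ) → 1 ≤ n →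
      -- well-defined: G_𝓕 is a labelled tree of the required kind
      (∀ (𝓕 : Family n) → Admissible 𝓕 → ∃[ T ] (IsTree T × 𝓕 ≅G T))
      -- injective (up to isomorphism)
    × (∀ (𝓕 𝓕' : Family n) (T : LGraph n) → Admissible 𝓕 → Admissible 𝓕' →
         𝓕 ≅G T → 𝓕' ≅G T → ∀ G → 𝓕 G ≡ 𝓕' G)
      -- surjective (up to isomorphism)
    × (∀ (T : LGraph n) → IsTree T → ∃[ 𝓕 ] (Admissible 𝓕 × 𝓕 ≅G T))
mainTheorem2 (suc m) _ =
    family⇒tree
  , (λ 𝓕 𝓕′ T adm _ → graph-determines-family 𝓕 𝓕′ T adm)
  , tree⇒family
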